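{- Let $d\ge1$, $r\ge 2$, let $e_1,\dots,e_{r-1}\ge 2$ be integers with $\sum_{j=1}^{r-1}(e_j-1)=d-1$, let $\tau\in S_d$ be a $d$-cycle, let $S=\{s_1<\cdots<s_{r-1}\}$ be a set of integers disjoint from $\{0,1,\dots,d\}$, and let $G$ be the factorization graph of a factorization of $\tau$ of type $(e_1,\dots,e_{r-1})$. Then $s_{r-1}$ has the consecutive partition property (CPP) on $(G,\tau)$.
   Context: Permutations compose right-to-left. A factorization of $\tau$ of type $(e_1,\dots,e_{r-1})$ is a tuple $(\sigma_1,\dots,\sigma_{r-1})$ with each $\sigma_i\in S_d$ an $e_i$-cycle and $\sigma_1\cdots\sigma_{r-1}=\tau$; its factorization graph has vertex set $S\cup[d]$ and edges $\{s_j,\nu\}$ for $\nu\in\mathrm{supp}(\sigma_j)$. $C_\tau$ is the circle with nodes $1,\dots,d$ in the clockwise order given by $\tau$; a consecutive piece of $C_\tau$ is a set $\{a,\tau(a),\dots,\tau^{m-1}(a)\}$. For a tree $G$ with vertex set $S'\cup\mathrm{supp}(\gamma)$ ($S'\subseteq S$, $\gamma$ a cycle) in which every edge joins $S'$ to $\mathrm{supp}(\gamma)$, a vertex $s\in S'$ has CPP on $(G,\gamma)$ if, after removing $s$ and its incident edges, the sets of $\mathrm{supp}(\gamma)$-vertices of the resulting subtrees form a partition of $\mathrm{supp}(\gamma)$ into consecutive pieces of the circle $C_\gamma$. -}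

module Defs where

open import Data.Nat using (ℕ; zero; suc; _<_; _∸_)
open import Data.Fin using (Fin; zero; suc)
open import Data.Fin.Permutation using (Permutation′; _⟨$⟩ʳ_)
open import Data.List using (map; allFin)
open import Data.Nat.ListAction using (sum)
open import Data.Sum using (_⊎_; inj₁; inj₂)
open import Data.Product using (Σ; ∃; _×_; _,_)
open import Function using (_∘_; _⇔_)
open import Relation.Binary.PropositionalEquality using (_≡_; _≢_)

iter : ∀ {d} → (Fin d → Fin d) → ℕ → Fin d → Fin d
iter f zero    x = x
iter f (suc i) x = f (iter f i x)

Supp : ∀ {d} → Permutation′ d → Fin d → Set
Supp σ ν = σ ⟨$⟩ʳ ν ≢ ν

IsCycle : ∀ {d} → ℕ → Permutation′ d → Set
IsCycle {d} e σ = Σ (Fin d) λ a →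
    (∀ i j → i < e → j < e → iter (σ ⟨$⟩ʳ_) i a ≡ iter (σ ⟨$⟩ʳ_) j a → i ≡ j)
  × (iter (σ ⟨$⟩ʳ_) e a ≡ a)
  × (∀ x → Supp σ x → Σ ℕ λ i → i < e × x ≡ iter (σ ⟨$⟩ʳ_) i a)

-- product σ₁ ⋯ σ_k applied to x (right-to-left composition): σ₁ (σ₂ ( ⋯ (σ_k x)))
prodApply : ∀ {d} k → (Fin k → Permutation′ d) → Fin d → Fin d
prodApply zero    σ x = x
prodApply (suc k) σ x = σ zero ⟨$⟩ʳ prodApply k (σ ∘ suc) x

sumMinusOne : ∀ k → (Fin k → ℕ) → ℕ
sumMinusOne k e = sum (map (λ j → e j ∸ 1) (allFin k))

-- Factorization graph: vertices S ⊎ [d], where S is indexed by Fin k (s_j ↦ j).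
Vertex : ℕ → ℕ → Set
Vertex k d = Fin k ⊎ Fin d

-- Edge {s_j, ν} iff ν ∈ supp(σ_j), restricted to the graph with vertex s removed
-- (edges incident to s are deleted).
data EdgeWithout {k d} (σ : Fin k → Permutation′ d) (s : Fin k) :
       Vertex k d → Vertex k d → Set where
  sν : ∀ j ν → j ≢ s → Supp (σ j) ν → EdgeWithout σ s (inj₁ j) (inj₂ ν)
  νs : ∀ j ν → j ≢ s → Supp (σ j) ν → EdgeWithout σ s (inj₂ ν) (inj₁ j)

data ConnWithout {k d} (σ : Fin k → Permutation′ d) (s : Fin k) :
       Vertex k d → Vertex k d → Set where
  here : ∀ {u} → ConnWithout σ s u u
  step : ∀ {u v w} → EdgeWithout σ s u v → ConnWithout σ s v w → ConnWithout σ s u w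

ConsecutivePiece : ∀ {d} → Permutation′ d → (Fin d → Set) → Set
ConsecutivePiece {d} τ P = Σ (Fin d) λ a → Σ ℕ λ m → (0 < m) ×
  (∀ x → P x ⇔ (Σ ℕ λ i → i < m × x ≡ iter (τ ⟨$⟩ʳ_) i a))

-- CPP of s on (G, τ): the [d]-vertex sets of the connected components of G − s
-- (i.e. the classes of [d] under connectivity in G − s; every component contains a
-- [d]-vertex) are consecutive pieces of C_τ.
HasCPP : ∀ {k d} → (Fin k → Permutation′ d) → Permutation′ d → Fin k → Set
HasCPP σ τ s = ∀ ν → ConsecutivePiece τ (λ μ → ConnWithout σ s (inj₂ ν) (inj₂ μ))

-- Let s be the last factor. As far as the points of [d] are concerned, G − s is
-- connected like the graph joining the first point of each other cycle σ j to the
-- rest of its support; it has Σ_{j ≢ s} (e j − 1) = d − e s edges. Adding the e s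
-- edges from one point x of supp σ s to all of supp σ s gives a connected graph,
-- since τ = σ 1 ⋯ σ (r−1) is a d-cycle. A connected graph on d points needs d − 1
-- edges that each join two components, so at most one of the added edges may be
-- redundant: no y ≢ x of supp σ s lies in the component of x in G − s. Finally a
-- component K of G − s can only be left along C_τ at a point x moved by σ s (otherwise
-- τ x is reached from x through the other factors), so K is left at most once, which
-- makes it a consecutive piece of C_τ.
module Submission where

open import Defs
open import Data.Nat using (ℕ; zero; suc; _≤_; _<_; _∸_; _+_; z≤n; s≤s; z<s; s≤s⁻¹)
open import Data.Nat.Properties hiding (_≟_)
open import Data.Nat.ListAction using (sum)
open import Data.Fin using (Fin; fromℕ; zero; suc; toℕ; punchOut; _≟_)
import Data.Fin.Properties as Finₚ
open import Algebra.Properties.CommutativeSemigroup +-commutativeSemigroup using (x∙yz≈y∙xz)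
open import Data.Fin.Permutation using (Permutation′; _⟨$⟩ʳ_)
open import Data.List using (List; []; _∷_; _++_; length; map; allFin; applyUpTo)
open import Data.List.Properties using (length-++; length-map; length-applyUpTo; map-cong)
open import Data.List.Membership.Propositional using (_∈_)
open import Data.List.Membership.Propositional.Properties
  using (∈-++⁺ˡ; ∈-++⁺ʳ; ∈-++⁻; ∈-allFin; ∈-map⁺; ∈-map⁻; ∈-applyUpTo⁺; ∈-applyUpTo⁻)
open import Data.List.Relation.Unary.Any using (here; there)
open import Data.Product using (∃; _×_; _,_; proj₁; proj₂)
open import Data.Sum using (_⊎_; inj₁; inj₂)
open import Function using (_∘_; id; case_of_; _⇔_; mk⇔; Injective; Injection)
open import Function.Properties.Inverse using (↔⇒↣)
open import Function.Construct.Composition using (_⇔-∘_)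
open import Function.Construct.Symmetry using (⇔-sym)
open import Relation.Nullary using (Dec; yes; no; ¬_; contradiction)
open import Relation.Nullary.Decidable using (decidable-stable; _×-dec_; ¬?)
open import Relation.Unary using (Decidable)
open import Relation.Binary using (Rel; Transitive; IsEquivalence; tri<; tri≈; tri>)
import Relation.Binary.Construct.Closure.Equivalence as EqClosure
open import Relation.Binary.Construct.Closure.ReflexiveTransitive using (ε; _◅_; _◅◅_)
open import Relation.Binary.Construct.Closure.Symmetric using (fwd; bwd)
open import Relation.Binary.PropositionalEquality

-- Counting points of Fin d

indicator : ∀ {a} {A : Set a} → Dec A → ℕ
indicator (yes _) = 1
indicator (no _)  = 0

indicator-mono : ∀ {A B : Set} → (A → B) → (a? : Dec A) (b? : Dec B) → indicator a? ≤ indicator b?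
indicator-mono f (yes a) (yes _) = ≤-refl
indicator-mono f (yes a) (no ¬b) = contradiction (f a) ¬b
indicator-mono f (no _)  _       = z≤n

indicator≤1 : ∀ {A : Set} (a? : Dec A) → indicator a? ≤ 1
indicator≤1 (yes _) = ≤-refl
indicator≤1 (no _)  = z≤n

indicator-yes : ∀ {A : Set} → A → (a? : Dec A) → 1 ≤ indicator a?
indicator-yes a (yes _) = ≤-refl
indicator-yes a (no ¬a) = contradiction a ¬a

count : ∀ {d} {P : Fin d → Set} → Decidable P → ℕ
count {zero}  P? = 0
count {suc d} P? = indicator (P? zero) + count (P? ∘ suc)

count-mono : ∀ {d} {P Q : Fin d → Set} (P? : Decidable P) (Q? : Decidable Q) →
             (∀ x → P x → Q x) → count P? ≤ count Q?
count-mono {zero}  P? Q? P⊆Q = z≤n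
count-mono {suc d} P? Q? P⊆Q =
  +-mono-≤ (indicator-mono (P⊆Q zero) (P? zero) (Q? zero))
           (count-mono (P? ∘ suc) (Q? ∘ suc) (P⊆Q ∘ suc))

count-all : ∀ {d} {P : Fin d → Set} (P? : Decidable P) → (∀ x → P x) → count P? ≡ d
count-all {zero}  P? all = refl
count-all {suc d} P? all with P? zero
... | yes _  = cong suc (count-all (P? ∘ suc) (all ∘ suc))
... | no ¬p0 = contradiction (all zero) ¬p0

count-none : ∀ {d} {P : Fin d → Set} (P? : Decidable P) → (∀ x → ¬ P x) → count P? ≡ 0
count-none {zero}  P? none = refl
count-none {suc d} P? none with P? zero
... | yes p0 = contradiction p0 (none zero)
... | no _   = count-none (P? ∘ suc) (none ∘ suc)

count≤1 : ∀ {d} {P : Fin d → Set} (P? : Decidable P) →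
          (∀ x y → P x → P y → x ≡ y) → count P? ≤ 1
count≤1 {zero}  P? unique = z≤n
count≤1 {suc d} P? unique with P? zero
... | yes p0 = s≤s (≤-reflexive (count-none (P? ∘ suc)
                     (λ x px → Finₚ.0≢1+n (unique zero (suc x) p0 px))))
... | no _   = count≤1 (P? ∘ suc) (λ x y px py → Finₚ.suc-injective (unique (suc x) (suc y) px py))

count-mono-except : ∀ {d} {P Q : Fin d → Set} (P? : Decidable P) (Q? : Decidable Q) (p : Fin d) →
                    (∀ x → x ≢ p → P x → Q x) → count P? ≤ suc (count Q?)
count-mono-except {suc d} P? Q? zero P⊆Q =
  +-mono-≤ (indicator≤1 (P? zero))
           (≤-trans (count-mono (P? ∘ suc) (Q? ∘ suc) (λ x → P⊆Q (suc x) λ ()))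
                    (m≤n+m _ (indicator (Q? zero))))
count-mono-except {suc d} P? Q? (suc p) P⊆Q = begin
  indicator (P? zero) + count (P? ∘ suc)   ≤⟨ +-mono-≤ (indicator-mono (P⊆Q zero λ ()) (P? zero) (Q? zero))
                                                (count-mono-except (P? ∘ suc) (Q? ∘ suc) p
                                                  (λ x x≢p → P⊆Q (suc x) (x≢p ∘ Finₚ.suc-injective))) ⟩
  indicator (Q? zero) + suc (count (Q? ∘ suc)) ≡⟨ +-suc _ _ ⟩
  suc (count Q?)                                ∎
  where open ≤-Reasoning

-- Connectivity of edge lists, and counting components by union–find

Edge : ℕ → Set
Edge d = Fin d × Fin d

module _ {d : ℕ} where

  Connected : List (Edge d) → Rel (Fin d) _
  Connected L = EqClosure.EqClosure (λ u v → (u , v) ∈ L)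

  edge : ∀ {L u v} → (u , v) ∈ L → Connected L u v
  edge = EqClosure.return

  Connected-sym : ∀ {L x y} → Connected L x y → Connected L y x
  Connected-sym = EqClosure.symmetric _

  Connected-⊆ : ∀ {L L′ x y} → (∀ {e} → e ∈ L → e ∈ L′) → Connected L x y → Connected L′ x y
  Connected-⊆ L⊆L′ = EqClosure.map L⊆L′

  redirect : Fin d → Fin d → Fin d → Fin d
  redirect a b ℓ with ℓ ≟ a
  ... | yes _ = b
  ... | no _  = ℓ

  redirect-hit : ∀ a b → redirect a b a ≡ b
  redirect-hit a b with a ≟ a
  ... | yes _  = refl
  ... | no a≢a = contradiction refl a≢a

  redirect-miss : ∀ {a ℓ} b → ℓ ≢ a → redirect a b ℓ ≡ ℓ
  redirect-miss {a} {ℓ} b ℓ≢a with ℓ ≟ a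
  ... | yes ℓ≡a = contradiction ℓ≡a ℓ≢a
  ... | no _    = refl

  redirect-target : ∀ a b → redirect a b b ≡ b
  redirect-target a b with b ≟ a
  ... | yes _ = refl
  ... | no _  = refl

  redirect-self : ∀ a ℓ → redirect a a ℓ ≡ ℓ
  redirect-self a ℓ with ℓ ≟ a
  ... | yes ℓ≡a = sym ℓ≡a
  ... | no _    = refl

  -- A labelling f names the class of x by f x; processing the edge (u , v)
  -- merges the class of v into that of u.
  merge : (Fin d → Fin d) → Fin d → Fin d → Fin d → Fin d
  merge f u v = redirect (f v) (f u) ∘ f

  label : (Fin d → Fin d) → List (Edge d) → Fin d → Fin d
  label f []            = f
  label f ((u , v) ∷ L) = label (merge f u v) L

  #roots : (Fin d → Fin d) → ℕ
  #roots f = count (λ x → f x ≟ x)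

  #redundant : (Fin d → Fin d) → List (Edge d) → ℕ
  #redundant f []            = 0
  #redundant f ((u , v) ∷ L) = indicator (f u ≟ f v) + #redundant f L

  label-++ : ∀ f L₁ L₂ → label f (L₁ ++ L₂) ≡ label (label f L₁) L₂
  label-++ f []              L₂ = refl
  label-++ f ((u , v) ∷ L₁) L₂ = label-++ (merge f u v) L₁ L₂

  label-resp : ∀ f L {x y} → f x ≡ f y → label f L x ≡ label f L y
  label-resp f []            fx≡fy = fx≡fy
  label-resp f ((u , v) ∷ L) fx≡fy = label-resp (merge f u v) L (cong (redirect (f v) (f u)) fx≡fy)

  label-edge : ∀ f L {u v} → (u , v) ∈ L → label f L u ≡ label f L v
  label-edge f ((u , v) ∷ L) (here refl) =
    label-resp (merge f u v) L (trans (redirect-target (f v) (f u)) (sym (redirect-hit (f v) (f u))))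
  label-edge f ((u , v) ∷ L) (there e∈L) = label-edge (merge f u v) L e∈L

  connected⇒sameLabel : ∀ f L {x y} → Connected L x y → label f L x ≡ label f L y
  connected⇒sameLabel f L = EqClosure.gfold isEquivalence (label f L) (label-edge f L)

  label-connected : ∀ {L} f L′ → (∀ x → Connected L x (f x)) → (∀ {e} → e ∈ L′ → e ∈ L) →
                    ∀ x → Connected L x (label f L′ x)
  label-connected f []            f-conn L′⊆L = f-conn
  label-connected f ((u , v) ∷ L′) f-conn L′⊆L =
    label-connected (merge f u v) L′ merge-conn (L′⊆L ∘ there)
    where
    merge-conn : ∀ x → Connected _ x (merge f u v x)
    merge-conn x with f x ≟ f v
    ... | yes fx≡fv = f-conn x ◅◅ subst (λ y → Connected _ y (f u)) (sym fx≡fv)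
                        (Connected-sym (f-conn v) ◅◅ Connected-sym (edge (L′⊆L (here refl))) ◅◅ f-conn u)
    ... | no _      = f-conn x

  sameLabel⇒connected : ∀ L {x y} → label id L x ≡ label id L y → Connected L x y
  sameLabel⇒connected L {x} {y} eq = subst (Connected L x) eq (path x) ◅◅ Connected-sym (path y)
    where path = label-connected id L (λ _ → ε) id

  #redundant-mono : ∀ f g L → (∀ {a b} → f a ≡ f b → g a ≡ g b) → #redundant f L ≤ #redundant g L
  #redundant-mono f g []            f⊆g = z≤n
  #redundant-mono f g ((u , v) ∷ L) f⊆g =
    +-mono-≤ (indicator-mono f⊆g (f u ≟ f v) (g u ≟ g v)) (#redundant-mono f g L f⊆g)

  #redundant-positive : ∀ f {L u v} → (u , v) ∈ L → f u ≡ f v → 1 ≤ #redundant f L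
  #redundant-positive f {(u , v) ∷ L} (here refl) fu≡fv =
    ≤-trans (indicator-yes fu≡fv (f u ≟ f v)) (m≤m+n _ _)
  #redundant-positive f {(u′ , v′) ∷ L} (there e∈L) fu≡fv =
    ≤-trans (#redundant-positive f e∈L fu≡fv) (m≤n+m _ _)

  -- An edge inside a class leaves the roots unchanged, while any other edge
  -- destroys at most one root: the root f v of the class merged away.
  #redundant+#roots≤length+#roots : ∀ f L → #redundant f L + #roots f ≤ length L + #roots (label f L)
  #redundant+#roots≤length+#roots f []            = ≤-refl
  #redundant+#roots≤length+#roots f ((u , v) ∷ L) with f u ≟ f v
  ... | yes fu≡fv = s≤s (begin
    #redundant f L + #roots f    ≤⟨ +-mono-≤ (#redundant-mono f f′ L (cong (redirect (f v) (f u))))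
                                     (count-mono _ _ λ x fx≡x → trans (merge-inert x) fx≡x) ⟩
    #redundant f′ L + #roots f′  ≤⟨ #redundant+#roots≤length+#roots f′ L ⟩
    length L + #roots (label f′ L) ∎)
    where
    open ≤-Reasoning
    f′ = merge f u v
    merge-inert : ∀ x → f′ x ≡ f x
    merge-inert x = subst (λ a → redirect (f v) a (f x) ≡ f x) (sym fu≡fv) (redirect-self (f v) (f x))
  ... | no _ = begin
    #redundant f L + #roots f          ≤⟨ +-mono-≤ (#redundant-mono f f′ L (cong (redirect (f v) (f u))))
                                          (count-mono-except _ _ (f v) λ x x≢fv fx≡x →
                                            trans (redirect-miss (f u) (x≢fv ∘ trans (sym fx≡x))) fx≡x) ⟩
    #redundant f′ L + suc (#roots f′)  ≡⟨ +-suc _ _ ⟩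
    suc (#redundant f′ L + #roots f′)  ≤⟨ s≤s (#redundant+#roots≤length+#roots f′ L) ⟩
    suc (length L + #roots (label f′ L)) ∎
    where
    open ≤-Reasoning
    f′ = merge f u v

  -- L leaves at least d − length L classes, and merging them all into one uses
  -- at least that many minus one of the non-redundant edges of Q.
  connected⇒#redundant+size≤length : ∀ L Q → (∀ x y → Connected (L ++ Q) x y) →
                                     #redundant (label id L) Q + d ≤ suc (length L + length Q)
  connected⇒#redundant+size≤length L Q connected = begin
    r + d                        ≤⟨ +-monoʳ-≤ r components-after-L ⟩
    r + (length L + #roots f₁)   ≡⟨ x∙yz≈y∙xz r (length L) _ ⟩
    length L + (r + #roots f₁)   ≤⟨ +-monoʳ-≤ (length L) components-after-Q ⟩
    length L + suc (length Q)    ≡⟨ +-suc _ _ ⟩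
    suc (length L + length Q)    ∎
    where
    open ≤-Reasoning
    f₁ = label id L
    r  = #redundant f₁ Q
    components-after-L : d ≤ length L + #roots f₁
    components-after-L = begin
      d                              ≡⟨ count-all (λ x → x ≟ x) (λ _ → refl) ⟨
      #roots id                      ≤⟨ m≤n+m _ _ ⟩
      #redundant id L + #roots id    ≤⟨ #redundant+#roots≤length+#roots id L ⟩
      length L + #roots f₁           ∎
    single-root : #roots (label f₁ Q) ≤ 1
    single-root = count≤1 _ λ x y gx≡x gy≡y → trans (sym gx≡x) (trans (same-label x y) gy≡y)
      where
      same-label : ∀ x y → label f₁ Q x ≡ label f₁ Q y
      same-label x y = subst (λ g → g x ≡ g y) (label-++ id L Q)
                         (connected⇒sameLabel id (L ++ Q) (connected x y))
    components-after-Q : r + #roots f₁ ≤ suc (length Q)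
    components-after-Q = begin
      r + #roots f₁                   ≤⟨ #redundant+#roots≤length+#roots f₁ Q ⟩
      length Q + #roots (label f₁ Q)  ≤⟨ +-monoʳ-≤ (length Q) single-root ⟩
      length Q + 1                    ≡⟨ +-comm (length Q) 1 ⟩
      suc (length Q)                  ∎

  star : Fin d → List (Fin d) → List (Edge d)
  star x = map (x ,_)

  star-#redundant≥2 : ∀ f x {ys u v} → u ∈ ys → v ∈ ys → u ≢ v → f x ≡ f u → f x ≡ f v →
                      2 ≤ #redundant f (star x ys)
  star-#redundant≥2 f x (here refl) (here refl) u≢v _ _ = contradiction refl u≢v
  star-#redundant≥2 f x {u ∷ _} (here refl) (there v∈) _ fx≡fu fx≡fv =
    +-mono-≤ (indicator-yes fx≡fu (f x ≟ f u)) (#redundant-positive f (∈-map⁺ (x ,_) v∈) fx≡fv)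
  star-#redundant≥2 f x {v ∷ _} (there u∈) (here refl) _ fx≡fu fx≡fv =
    +-mono-≤ (indicator-yes fx≡fv (f x ≟ f v)) (#redundant-positive f (∈-map⁺ (x ,_) u∈) fx≡fu)
  star-#redundant≥2 f x {_ ∷ _} (there u∈) (there v∈) u≢v fx≡fu fx≡fv =
    ≤-trans (star-#redundant≥2 f x u∈ v∈ u≢v fx≡fu fx≡fv) (m≤n+m _ _)

-- Iterates and cycles

iter-+ : ∀ {d} (f : Fin d → Fin d) m n x → iter f (m + n) x ≡ iter f m (iter f n x)
iter-+ f zero    n x = refl
iter-+ f (suc m) n x = cong f (iter-+ f m n x)

iter-comm : ∀ {d} (f : Fin d → Fin d) m n x → iter f m (iter f n x) ≡ iter f n (iter f m x)
iter-comm f m n x = begin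
  iter f m (iter f n x) ≡⟨ iter-+ f m n x ⟨
  iter f (m + n) x      ≡⟨ cong (λ k → iter f k x) (+-comm m n) ⟩
  iter f (n + m) x      ≡⟨ iter-+ f n m x ⟩
  iter f n (iter f m x) ∎
  where open ≡-Reasoning

iter-injective : ∀ {d} {f : Fin d → Fin d} → Injective _≡_ _≡_ f →
                 ∀ i {x y} → iter f i x ≡ iter f i y → x ≡ y
iter-injective f-inj zero    eq = eq
iter-injective f-inj (suc i) eq = iter-injective f-inj i (f-inj eq)

⟨$⟩ʳ-injective : ∀ {d} (σ : Permutation′ d) → Injective _≡_ _≡_ (σ ⟨$⟩ʳ_)
⟨$⟩ʳ-injective σ = Injection.injective (↔⇒↣ σ)

Supp-⟨$⟩ʳ : ∀ {d} (σ : Permutation′ d) {w} → Supp σ w → Supp σ (σ ⟨$⟩ʳ w)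
Supp-⟨$⟩ʳ σ w-moved = w-moved ∘ ⟨$⟩ʳ-injective σ

Supp-iter : ∀ {d} (σ : Permutation′ d) {w} → Supp σ w → ∀ k → Supp σ (iter (σ ⟨$⟩ʳ_) k w)
Supp-iter σ w-moved zero    = w-moved
Supp-iter σ w-moved (suc k) = Supp-⟨$⟩ʳ σ (Supp-iter σ w-moved k)

hub⇒related : ∀ {d ℓ} {R : Rel (Fin d) ℓ} → IsEquivalence R → (σ : Permutation′ d) (c : Fin d) →
              (∀ {w} → Supp σ w → R c w) → ∀ y → R y (σ ⟨$⟩ʳ y)
hub⇒related R-equiv σ c hub y = case σ ⟨$⟩ʳ y ≟ y of λ
  { (yes fixed) → R.reflexive (sym fixed)
  ; (no moved)  → R.trans (R.sym (hub moved)) (hub (Supp-⟨$⟩ʳ σ moved)) }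
  where module R = IsEquivalence R-equiv

injective⇒surjective : ∀ {d} (h : Fin d → Fin d) → Injective _≡_ _≡_ h → ∀ z → ∃ λ k → h k ≡ z
injective⇒surjective {suc m} h h-inj z with Finₚ.any? (λ k → h k ≟ z)
... | yes hit = hit
... | no miss with i , j , i<j , eq ← Finₚ.pigeonhole (n<1+n m) (λ k → punchOut (miss ∘ (k ,_) ∘ sym))
  = contradiction (h-inj (Finₚ.punchOut-injective (miss ∘ (i ,_) ∘ sym) (miss ∘ (j ,_) ∘ sym) eq))
                  (Finₚ.<⇒≢ i<j)

module Cycle {d e : ℕ} (σ : Permutation′ d) (cycle : IsCycle e σ) where

  private
    g = σ ⟨$⟩ʳ_
    distinct = proj₁ (proj₂ cycle)
    covers   = proj₂ (proj₂ (proj₂ cycle))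

  start : Fin d
  start = proj₁ cycle

  points : List (Fin d)
  points = applyUpTo (λ i → iter g i start) e

  Supp⊆points : ∀ {w} → Supp σ w → w ∈ points
  Supp⊆points w-moved with i , i<e , refl ← covers _ w-moved = ∈-applyUpTo⁺ _ i<e

  spokes : List (Edge d)
  spokes = star start (applyUpTo (λ i → iter g (suc i) start) (e ∸ 1))

  length-spokes : length spokes ≡ e ∸ 1
  length-spokes = trans (length-map (start ,_) (applyUpTo _ (e ∸ 1))) (length-applyUpTo _ (e ∸ 1))

  spokes⊆Supp : ∀ {u v} → (u , v) ∈ spokes → Supp σ u × Supp σ v
  spokes⊆Supp uv∈ with w , w∈ , refl ← ∈-map⁻ (start ,_) uv∈
                  with i , i<e∸1 , refl ← ∈-applyUpTo⁻ _ w∈ = start-moved , Supp-iter σ start-moved (suc i)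
    where
    1<e : 1 < e
    1<e = m∸n≢0⇒n<m (λ e∸1≡0 → contradiction (subst (i <_) e∸1≡0 i<e∸1) λ ())
    start-moved : Supp σ start
    start-moved fixed = contradiction (distinct 1 0 1<e (<-trans z<s 1<e) fixed) λ ()

  spokes-connect : ∀ {w} → Supp σ w → Connected spokes start w
  spokes-connect w-moved with covers _ w-moved
  ... | zero  , _     , refl = ε
  ... | suc i , si<e , refl = edge (∈-map⁺ (start ,_) (∈-applyUpTo⁺ _ (<⇒≤pred si<e)))

minimal-or-none : ∀ {P : ℕ → Set} → Decidable P → ∀ k →
                  (∃ λ p → p < k × P p × (∀ i → i < p → ¬ P i)) ⊎ (∀ i → i < k → ¬ P i)
minimal-or-none P? zero    = inj₂ λ _ ()
minimal-or-none P? (suc k) with minimal-or-none P? k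
... | inj₁ (p , p<k , Pp , minimal) = inj₁ (p , m<n⇒m<1+n p<k , Pp , minimal)
... | inj₂ none with P? k
...   | yes Pk = inj₁ (k , n<1+n k , Pk , none)
...   | no ¬Pk = inj₂ λ i i<1+k → case m<1+n⇒m<n∨m≡n i<1+k of λ
          { (inj₁ i<k)  → none i i<k
          ; (inj₂ refl) → ¬Pk }

ConsecutivePiece-resp : ∀ {d} (τ : Permutation′ d) {P Q : Fin d → Set} →
                        (∀ x → P x ⇔ Q x) → ConsecutivePiece τ P → ConsecutivePiece τ Q
ConsecutivePiece-resp τ P⇔Q (a , m , 0<m , P⇔arc) = a , m , 0<m , λ x → P⇔arc x ⇔-∘ ⇔-sym (P⇔Q x)

module FullCycle {d : ℕ} (τ : Permutation′ d) (cycle : IsCycle d τ) where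

  T : Fin d → Fin d
  T = τ ⟨$⟩ʳ_

  private
    a₀ = proj₁ cycle
    a₀-distinct = proj₁ (proj₂ cycle)

    orbit-surjective : ∀ b → (∀ {i j} → i < d → j < d → iter T i b ≡ iter T j b → i ≡ j) →
                       ∀ z → ∃ λ i → i < d × z ≡ iter T i b
    orbit-surjective b inj z
      with k , eq ← injective⇒surjective (λ k → iter T (toℕ k) b)
                      (Finₚ.toℕ-injective ∘ inj (Finₚ.toℕ<n _) (Finₚ.toℕ<n _)) z
      = toℕ k , Finₚ.toℕ<n k , sym eq

    no-return : ∀ b {t} → 0 < t → t < d → iter T t b ≢ b
    no-return b {t} 0<t t<d returns
      with j , _ , refl ← orbit-surjective a₀ (a₀-distinct _ _) b
      = <-irrefl (sym t≡0) 0<t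
      where
      t≡0 : t ≡ 0
      t≡0 = a₀-distinct t 0 t<d (≤-<-trans z≤n t<d)
              (iter-injective (⟨$⟩ʳ-injective τ) j (trans (iter-comm T j t a₀) returns))

    distinct-below : ∀ b {i j} → i < j → j < d → iter T i b ≢ iter T j b
    distinct-below b {i} {j} i<j j<d eq =
      no-return b (m<n⇒0<n∸m i<j) (≤-<-trans (m∸n≤m j i) j<d)
        (sym (iter-injective (⟨$⟩ʳ-injective τ) i (begin
          iter T i b                  ≡⟨ eq ⟩
          iter T j b                  ≡⟨ cong (λ k → iter T k b) (m+[n∸m]≡n (<⇒≤ i<j)) ⟨
          iter T (i + (j ∸ i)) b      ≡⟨ iter-+ T i (j ∸ i) b ⟩
          iter T i (iter T (j ∸ i) b) ∎)))
      where open ≡-Reasoning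

  orbit-injective : ∀ b {i j} → i < d → j < d → iter T i b ≡ iter T j b → i ≡ j
  orbit-injective b {i} {j} i<d j<d eq with <-cmp i j
  ... | tri< i<j _ _ = contradiction eq (distinct-below b i<j j<d)
  ... | tri≈ _ i≡j _ = i≡j
  ... | tri> _ _ j<i = contradiction (sym eq) (distinct-below b j<i i<d)

  orbit-complete : ∀ b z → ∃ λ i → i < d × z ≡ iter T i b
  orbit-complete b = orbit-surjective b (orbit-injective b)

  step-closed⇒total : ∀ {ℓ} (R : Rel (Fin d) ℓ) → (∀ {z} → R z z) → Transitive R →
                      (∀ z → R z (T z)) → ∀ u v → R u v
  step-closed⇒total R R-refl R-trans R-step u v with i , _ , refl ← orbit-complete u v = along i
    where
    along : ∀ i → R u (iter T i u)
    along zero    = R-refl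
    along (suc i) = R-trans (along i) (R-step _)

  Exit : (Fin d → Set) → Fin d → Set
  Exit K x = K x × ¬ K (T x)

  closed⇒consecutive : ∀ {K : Fin d → Set} {ν} → K ν → (∀ x → K x → K (T x)) → ConsecutivePiece τ K
  closed⇒consecutive {K} {ν} Kν closed =
    ν , d , ≤-<-trans z≤n (Finₚ.toℕ<n ν) , λ z → mk⇔ (λ _ → orbit-complete ν z) λ { (i , _ , refl) → along i }
    where
    along : ∀ i → K (iter T i ν)
    along zero    = Kν
    along (suc i) = closed _ (along i)

  module _ {K : Fin d → Set} (K? : Decidable K) (exit-unique : ∀ {x y} → Exit K x → Exit K y → x ≡ y) where

    -- Reading C_τ from b = τ x, K is entered at its first point τ^p b and never left before x.
    exit⇒consecutive : ∀ {ν x} → K ν → Exit K x → ConsecutivePiece τ K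
    exit⇒consecutive {ν} {x} Kν exit-x
      with iν , iν<d , refl ← orbit-complete (T x) ν
      with minimal-or-none (λ i → K? (iter T i (T x))) (suc iν)
    ... | inj₂ none = contradiction Kν (none iν (n<1+n iν))
    ... | inj₁ (p , p<1+iν , Kp , minimal) =
      iter T p b , d ∸ p , m<n⇒0<n∸m p<d , λ z → mk⇔ (K⇒arc z) (arc⇒K z)
      where
      b = T x
      p<d : p < d
      p<d = ≤-<-trans (s≤s⁻¹ p<1+iν) iν<d
      advance : ∀ i → suc i < d → K (iter T i b) → K (iter T (suc i) b)
      advance i 1+i<d Ki with K? (iter T (suc i) b)
      ... | yes K1+i = K1+i
      ... | no ¬K1+i = contradiction
              (orbit-injective b 1+i<d (<-trans z<s 1+i<d) (cong T (exit-unique (Ki , ¬K1+i) exit-x)))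
              λ ()
      from-p : ∀ t → t + p < d → K (iter T (t + p) b)
      from-p zero    _     = Kp
      from-p (suc t) 1+t+p<d = advance (t + p) 1+t+p<d (from-p t (<-trans (n<1+n _) 1+t+p<d))
      K⇒arc : ∀ z → K z → ∃ λ t → t < d ∸ p × z ≡ iter T t (iter T p b)
      K⇒arc z Kz with i , i<d , refl ← orbit-complete b z = i ∸ p , ∸-monoˡ-< i<d p≤i , (begin
        iter T i b                  ≡⟨ cong (λ k → iter T k b) (m∸n+n≡m p≤i) ⟨
        iter T (i ∸ p + p) b        ≡⟨ iter-+ T (i ∸ p) p b ⟩
        iter T (i ∸ p) (iter T p b) ∎)
        where
        open ≡-Reasoning
        p≤i : p ≤ i
        p≤i = ≮⇒≥ λ i<p → minimal i i<p Kz
      arc⇒K : ∀ z → (∃ λ t → t < d ∸ p × z ≡ iter T t (iter T p b)) → K z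
      arc⇒K _ (t , t<d∸p , refl) = subst K (iter-+ T t p b) (from-p t (m≤o∸n⇒m+n≤o (suc t) (<⇒≤ p<d) t<d∸p))

    consecutive : ∀ {ν} → K ν → ConsecutivePiece τ K
    consecutive Kν with Finₚ.any? (λ x → K? x ×-dec ¬? (K? (T x)))
    ... | yes (x , exit-x) = exit⇒consecutive Kν exit-x
    ... | no no-exit       = closed⇒consecutive Kν λ x Kx →
                               decidable-stable (K? (T x)) λ ¬KTx → no-exit (x , Kx , ¬KTx)

-- Factorizations

prodApply-related : ∀ {d ℓ} (R : Rel (Fin d) ℓ) → Transitive R →
                    ∀ k (ρ : Fin (suc k) → Permutation′ d) x → R x (ρ (fromℕ k) ⟨$⟩ʳ x) →
                    (∀ j y → j ≢ fromℕ k → R y (ρ j ⟨$⟩ʳ y)) → R x (prodApply (suc k) ρ x)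
prodApply-related R R-trans zero    ρ x R-last R-others = R-last
prodApply-related R R-trans (suc k) ρ x R-last R-others =
  R-trans (prodApply-related R R-trans k (ρ ∘ suc) x R-last (λ j y j≢last → R-others (suc j) y (j≢last ∘ Finₚ.suc-injective)))
          (R-others zero _ λ ())

concatExcept : ∀ {k} {A : Set} → Fin k → (Fin k → List A) → List (Fin k) → List A
concatExcept s E []       = []
concatExcept s E (j ∷ js) with j ≟ s
... | yes _ = concatExcept s E js
... | no _  = E j ++ concatExcept s E js

module _ {k} {A : Set} (s : Fin k) (E : Fin k → List A) where

  ∈-concatExcept⁺ : ∀ {j js x} → j ∈ js → j ≢ s → x ∈ E j → x ∈ concatExcept s E js
  ∈-concatExcept⁺ {js = j ∷ js} (here refl) j≢s x∈ with j ≟ s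
  ... | yes j≡s = contradiction j≡s j≢s
  ... | no _    = ∈-++⁺ˡ x∈
  ∈-concatExcept⁺ {js = j′ ∷ js} (there j∈) j≢s x∈ with j′ ≟ s
  ... | yes _ = ∈-concatExcept⁺ j∈ j≢s x∈
  ... | no _  = ∈-++⁺ʳ (E j′) (∈-concatExcept⁺ j∈ j≢s x∈)

  ∈-concatExcept⁻ : ∀ js {x} → x ∈ concatExcept s E js → ∃ λ j → j ≢ s × x ∈ E j
  ∈-concatExcept⁻ (j ∷ js) x∈ with j ≟ s
  ... | yes _   = ∈-concatExcept⁻ js x∈
  ... | no j≢s with ∈-++⁻ (E j) x∈
  ...   | inj₁ x∈Ej   = j , j≢s , x∈Ej
  ...   | inj₂ x∈rest = ∈-concatExcept⁻ js x∈rest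

  length-concatExcept≤ : ∀ js → length (concatExcept s E js) ≤ sum (map (length ∘ E) js)
  length-concatExcept≤ []       = z≤n
  length-concatExcept≤ (j ∷ js) with j ≟ s
  ... | yes _ = ≤-trans (length-concatExcept≤ js) (m≤n+m _ _)
  ... | no _  = ≤-trans (≤-reflexive (length-++ (E j))) (+-monoʳ-≤ (length (E j)) (length-concatExcept≤ js))

  length-concatExcept : ∀ {js} → s ∈ js → length (concatExcept s E js) + length (E s) ≤ sum (map (length ∘ E) js)
  length-concatExcept {j ∷ js} (here refl) with j ≟ s
  ... | yes _  = ≤-trans (≤-reflexive (+-comm _ (length (E s))))
                        (+-monoʳ-≤ (length (E s)) (length-concatExcept≤ js))
  ... | no s≢s = contradiction refl s≢s
  length-concatExcept {j ∷ js} (there s∈) with j ≟ s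
  ... | yes _ = ≤-trans (length-concatExcept s∈) (m≤n+m _ _)
  ... | no _  = begin
    length (E j ++ concatExcept s E js) + length (E s)           ≡⟨ cong (_+ length (E s)) (length-++ (E j)) ⟩
    length (E j) + length (concatExcept s E js) + length (E s)   ≡⟨ +-assoc (length (E j)) _ _ ⟩
    length (E j) + (length (concatExcept s E js) + length (E s)) ≤⟨ +-monoʳ-≤ (length (E j)) (length-concatExcept s∈) ⟩
    length (E j) + sum (map (length ∘ E) js)                     ∎
    where open ≤-Reasoning

module LastFactor {d n : ℕ} {e : Fin (suc n) → ℕ} (σ : Fin (suc n) → Permutation′ d)
                  (σ-cycles : ∀ j → IsCycle (e j) (σ j)) where

  module C (j : Fin (suc n)) = Cycle (σ j) (σ-cycles j)

  s : Fin (suc n)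
  s = fromℕ n

  -- G − s, as far as connectivity between points of [d] goes
  spokeGraph : List (Edge d)
  spokeGraph = concatExcept s C.spokes (allFin (suc n))

  spokes⊆spokeGraph : ∀ {j uv} → j ≢ s → uv ∈ C.spokes j → uv ∈ spokeGraph
  spokes⊆spokeGraph j≢s = ∈-concatExcept⁺ s C.spokes (∈-allFin _) j≢s

  start-connected : ∀ {j w} → j ≢ s → Supp (σ j) w → Connected spokeGraph (C.start j) w
  start-connected j≢s = Connected-⊆ (spokes⊆spokeGraph j≢s) ∘ C.spokes-connect _

  σ-connected : ∀ {j} → j ≢ s → ∀ y → Connected spokeGraph y (σ j ⟨$⟩ʳ y)
  σ-connected {j} j≢s = hub⇒related (EqClosure.isEquivalence _) (σ j) (C.start j) (start-connected j≢s)

  vertex : Vertex (suc n) d → Fin d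
  vertex (inj₁ j) = C.start j
  vertex (inj₂ ν) = ν

  ConnWithout⇒Connected : ∀ {u v} → ConnWithout σ s u v → Connected spokeGraph (vertex u) (vertex v)
  ConnWithout⇒Connected here                             = ε
  ConnWithout⇒Connected (step (sν j ν j≢s ν-moved) path) =
    start-connected j≢s ν-moved ◅◅ ConnWithout⇒Connected path
  ConnWithout⇒Connected (step (νs j ν j≢s ν-moved) path) =
    Connected-sym (start-connected j≢s ν-moved) ◅◅ ConnWithout⇒Connected path

  spokeGraph⊆Supp : ∀ {u v} → (u , v) ∈ spokeGraph → ∃ λ j → j ≢ s × Supp (σ j) u × Supp (σ j) v
  spokeGraph⊆Supp uv∈ with j , j≢s , uv∈j ← ∈-concatExcept⁻ s C.spokes (allFin (suc n)) uv∈ =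
    j , j≢s , C.spokes⊆Supp j uv∈j

  Connected⇒ConnWithout : ∀ {x y} → Connected spokeGraph x y → ConnWithout σ s (inj₂ x) (inj₂ y)
  Connected⇒ConnWithout ε = here
  Connected⇒ConnWithout (fwd uv∈ ◅ path) with j , j≢s , u-moved , v-moved ← spokeGraph⊆Supp uv∈ =
    step (νs j _ j≢s u-moved) (step (sν j _ j≢s v-moved) (Connected⇒ConnWithout path))
  Connected⇒ConnWithout (bwd vu∈ ◅ path) with j , j≢s , v-moved , u-moved ← spokeGraph⊆Supp vu∈ =
    step (νs j _ j≢s u-moved) (step (sν j _ j≢s v-moved) (Connected⇒ConnWithout path))

  length-spokeGraph : 1 ≤ d → 1 ≤ e s → sumMinusOne (suc n) e ≡ d ∸ 1 → length spokeGraph + e s ≤ d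
  length-spokeGraph 1≤d 1≤es sum≡ = begin
    length spokeGraph + e s            ≡⟨ cong (length spokeGraph +_) (m∸n+n≡m 1≤es) ⟨
    length spokeGraph + (e s ∸ 1 + 1)  ≡⟨ +-assoc (length spokeGraph) _ 1 ⟨
    length spokeGraph + (e s ∸ 1) + 1  ≤⟨ +-monoˡ-≤ 1 (≤-trans within (≤-reflexive total)) ⟩
    d ∸ 1 + 1                          ≡⟨ m∸n+n≡m 1≤d ⟩
    d                                  ∎
    where
    open ≤-Reasoning
    within : length spokeGraph + (e s ∸ 1) ≤ sum (map (length ∘ C.spokes) (allFin (suc n)))
    within = subst (λ m → length spokeGraph + m ≤ sum (map (length ∘ C.spokes) (allFin (suc n))))
               (C.length-spokes s)
               (length-concatExcept s C.spokes (∈-allFin s))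
    total : sum (map (length ∘ C.spokes) (allFin (suc n))) ≡ d ∸ 1
    total = trans (cong sum (map-cong {f = length ∘ C.spokes} C.length-spokes (allFin (suc n)))) sum≡

  module _ (τ : Permutation′ d) (τ-cycle : IsCycle d τ)
           (product : ∀ x → prodApply (suc n) σ x ≡ τ ⟨$⟩ʳ x) where

    fixed⇒τ-connected : ∀ {x} → σ s ⟨$⟩ʳ x ≡ x → Connected spokeGraph x (τ ⟨$⟩ʳ x)
    fixed⇒τ-connected {x} fixed = subst (Connected spokeGraph x) (product x)
      (prodApply-related (Connected spokeGraph) _◅◅_ n σ x (subst (Connected spokeGraph x) (sym fixed) ε)
        λ j y j≢s → σ-connected j≢s y)

    Supp-separated : length spokeGraph + e s ≤ d → ∀ {x y} → Supp (σ s) x → Supp (σ s) y →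
                     Connected spokeGraph x y → x ≡ y
    Supp-separated few-edges {x} {y} x-moved y-moved x~y with x ≟ y
    ... | yes x≡y = x≡y
    ... | no x≢y  = contradiction (begin
      2 + d                                ≤⟨ +-monoˡ-≤ d (star-#redundant≥2 (label id spokeGraph) x
                                                (C.Supp⊆points s x-moved) (C.Supp⊆points s y-moved) x≢y
                                                refl (connected⇒sameLabel id spokeGraph x~y)) ⟩
      #redundant (label id spokeGraph) Q + d ≤⟨ connected⇒#redundant+size≤length spokeGraph Q Q-connects ⟩
      suc (length spokeGraph + length Q)   ≡⟨ cong (λ m → suc (length spokeGraph + m)) length-Q ⟩
      suc (length spokeGraph + e s)        ≤⟨ s≤s few-edges ⟩
      suc d                                ∎) (n≮n (suc d))
      where
      open ≤-Reasoning
      open FullCycle τ τ-cycle using (step-closed⇒total)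
      Q = star x (C.points s)
      length-Q : length Q ≡ e s
      length-Q = trans (length-map (x ,_) (C.points s)) (length-applyUpTo _ (e s))
      F = spokeGraph ++ Q
      σs-connected : ∀ z → Connected F z (σ s ⟨$⟩ʳ z)
      σs-connected = hub⇒related (EqClosure.isEquivalence _) (σ s) x
        λ w-moved → edge (∈-++⁺ʳ spokeGraph (∈-map⁺ (x ,_) (C.Supp⊆points s w-moved)))
      τ-connected : ∀ z → Connected F z (τ ⟨$⟩ʳ z)
      τ-connected z = subst (Connected F z) (product z)
        (prodApply-related (Connected F) _◅◅_ n σ z (σs-connected z)
          λ j y j≢s → Connected-⊆ ∈-++⁺ˡ (σ-connected j≢s y))
      Q-connects : ∀ u v → Connected F u v
      Q-connects = step-closed⇒total (Connected F) ε _◅◅_ τ-connected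

corollary4p2 : (d n : ℕ) → 1 ≤ d
    → (e : Fin (suc n) → ℕ) → (∀ j → 2 ≤ e j) → sumMinusOne (suc n) e ≡ d ∸ 1
    → (τ : Permutation′ d) → IsCycle d τ
    → (σ : Fin (suc n) → Permutation′ d) → (∀ j → IsCycle (e j) (σ j))
    → (∀ x → prodApply (suc n) σ x ≡ τ ⟨$⟩ʳ x)
    → HasCPP σ τ (fromℕ n)
corollary4p2 d n 1≤d e 2≤e sum≡ τ τ-cycle σ σ-cycles product ν =
  ConsecutivePiece-resp τ component⇔ (consecutive (λ μ → lab ν ≟ lab μ) exit-unique refl)
  where
  open LastFactor σ σ-cycles
  open FullCycle τ τ-cycle using (Exit; consecutive)
  lab : Fin d → Fin d
  lab = label id spokeGraph
  Component : Fin d → Set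
  Component μ = lab ν ≡ lab μ
  component⇔ : ∀ μ → Component μ ⇔ ConnWithout σ s (inj₂ ν) (inj₂ μ)
  component⇔ μ = mk⇔ (Connected⇒ConnWithout ∘ sameLabel⇒connected spokeGraph)
                     (connected⇒sameLabel id spokeGraph ∘ ConnWithout⇒Connected)
  exit⇒Supp : ∀ {x} → Exit Component x → Supp (σ s) x
  exit⇒Supp (ν~x , ν≁τx) fixed =
    ν≁τx (trans ν~x (connected⇒sameLabel id spokeGraph (fixed⇒τ-connected τ τ-cycle product fixed)))
  exit-unique : ∀ {x y} → Exit Component x → Exit Component y → x ≡ y
  exit-unique exit-x exit-y =
    Supp-separated τ τ-cycle product (length-spokeGraph 1≤d (<⇒≤ (2≤e s)) sum≡)
      (exit⇒Supp exit-x) (exit⇒Supp exit-y)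
      (sameLabel⇒connected spokeGraph (trans (sym (proj₁ exit-x)) (proj₁ exit-y)))
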